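{- The countable universal homogeneous echeloned space $\mathbf{F}$ is not isomorphic to the echeloned space induced by the rational Urysohn space, nor to the echeloned space induced by the bounded rational Urysohn space.
   Context: An echeloned space is a pair $(X,\leq_\mathbf{X})$ where $X$ is a non-empty set and $\leq_\mathbf{X}$ is a total preorder on $X^2$ such that for all $x,y,z$: $(x,x)\leq_\mathbf{X}(y,z)$; $(y,z)\leq_\mathbf{X}(x,x)$ implies $y=z$; $(x,y)\leq_\mathbf{X}(y,x)$. Isomorphisms are bijections $h$ with $(x_1,y_1)\leq_\mathbf{X}(x_2,y_2)\iff(h(x_1),h(y_1))\leq_\mathbf{Y}(h(x_2),h(y_2))$. A metric $d$ on $X$ induces the echeloned space with $(x_1,y_1)\leq(x_2,y_2)\iff d(x_1,y_1)\leq d(x_2,y_2)$. $\mathbf{F}$ is the Fraïssé limit of the class of finite echeloned spaces (the unique countable homogeneous echeloned space into which every finite echeloned space embeds). The rational Urysohn space is the Fraïssé limit of the class of finite metric spaces with rational distances; the bounded rational Urysohn space is the Fraïssé limit of the class of finite metric spaces with distances in $\mathbb{Q}\cap[0,1]$. -}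

module Defs where

open import Data.Nat using (ℕ)
open import Data.Fin using (Fin)
open import Data.Product using (Σ; ∃; _×_; _,_; proj₁; proj₂)
open import Data.Sum using (_⊎_)
open import Data.Rational using (ℚ; _≤_; _+_; 0ℚ; 1ℚ)
import Data.Rational.Properties as ℚP
open import Function.Bundles using (_↔_; Inverse; _⇔_)
open import Relation.Binary.PropositionalEquality using (_≡_; refl; sym; subst)

-- countable (and non-empty): a surjection from ℕ
Countable : Set → Set
Countable X = Σ (ℕ → X) λ f → ∀ y → ∃ λ n → f n ≡ y

InjectiveMap : {A B : Set} → (A → B) → Set
InjectiveMap f = ∀ {x y} → f x ≡ f y → x ≡ y

record Echeloned : Set₁ where
  field
    Carrier : Set
    point   : Carrier
    _≼_     : Carrier × Carrier → Carrier × Carrier → Set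
    ≼-refl  : ∀ p → p ≼ p
    ≼-trans : ∀ {p q r} → p ≼ q → q ≼ r → p ≼ r
    ≼-total : ∀ p q → (p ≼ q) ⊎ (q ≼ p)
    ax-diag : ∀ x y z → (x , x) ≼ (y , z)
    ax-zero : ∀ x y z → (y , z) ≼ (x , x) → y ≡ z
    ax-sym  : ∀ x y → (x , y) ≼ (y , x)

open Echeloned

record EchIso (X Y : Echeloned) : Set where
  field
    bij  : Carrier X ↔ Carrier Y
  h : Carrier X → Carrier Y
  h = Inverse.to bij
  field
    pres : ∀ x₁ y₁ x₂ y₂ →
      (_≼_ X (x₁ , y₁) (x₂ , y₂)) ⇔ (_≼_ Y (h x₁ , h y₁) (h x₂ , h y₂))

record EchEmb (X Y : Echeloned) : Set where
  field
    h    : Carrier X → Carrier Y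
    inj  : InjectiveMap h
    pres : ∀ x₁ y₁ x₂ y₂ →
      (_≼_ X (x₁ , y₁) (x₂ , y₂)) ⇔ (_≼_ Y (h x₁ , h y₁) (h x₂ , h y₂))

FiniteEch : Echeloned → Set
FiniteEch X = Σ ℕ λ n → Carrier X ↔ Fin n

-- homogeneity: every isomorphism between finite substructures
-- (given by enumerations a, b : Fin n → X) extends to an automorphism
HomogeneousEch : Echeloned → Set
HomogeneousEch X =
  (n : ℕ) (a b : Fin n → Carrier X) → InjectiveMap a → InjectiveMap b →
  (∀ i j k l → (_≼_ X (a i , a j) (a k , a l)) ⇔ (_≼_ X (b i , b j) (b k , b l))) →
  Σ (EchIso X X) λ σ → ∀ i → EchIso.h σ (a i) ≡ b i

record IsFraisseLimitEch (X : Echeloned) : Set₁ where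
  field
    countable   : Countable (Carrier X)
    homogeneous : HomogeneousEch X
    universal   : (A : Echeloned) → FiniteEch A → EchEmb A X

record MetricQ : Set₁ where
  field
    Carrier  : Set
    d        : Carrier → Carrier → ℚ
    d-nonneg : ∀ x y → 0ℚ ≤ d x y
    d-self   : ∀ x → d x x ≡ 0ℚ
    d-zero   : ∀ x y → d x y ≡ 0ℚ → x ≡ y
    d-sym    : ∀ x y → d x y ≡ d y x
    d-tri    : ∀ x y z → d x z ≤ d x y + d y z

module M = MetricQ

record Isometry (X Y : MetricQ) : Set where
  field
    h    : M.Carrier X → M.Carrier Y
    inj  : InjectiveMap h
    pres : ∀ x y → M.d Y (h x) (h y) ≡ M.d X x y

record IsometricIso (X Y : MetricQ) : Set where
  field
    bij  : M.Carrier X ↔ M.Carrier Y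
    pres : ∀ x y → M.d Y (Inverse.to bij x) (Inverse.to bij y) ≡ M.d X x y

FiniteMetric : MetricQ → Set
FiniteMetric X = Σ ℕ λ n → M.Carrier X ↔ Fin n

BoundedBy1 : MetricQ → Set
BoundedBy1 X = ∀ x y → M.d X x y ≤ 1ℚ

HomogeneousMetric : MetricQ → Set
HomogeneousMetric X =
  (n : ℕ) (a b : Fin n → M.Carrier X) → InjectiveMap a → InjectiveMap b →
  (∀ i j → M.d X (a i) (a j) ≡ M.d X (b i) (b j)) →
  Σ (IsometricIso X X) λ σ → ∀ i → Inverse.to (IsometricIso.bij σ) (a i) ≡ b i

record IsRationalUrysohn (U : MetricQ) : Set₁ where
  field
    countable   : Countable (M.Carrier U)
    homogeneous : HomogeneousMetric U
    universal   : (A : MetricQ) → FiniteMetric A → Isometry A U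

record IsBoundedRationalUrysohn (U : MetricQ) : Set₁ where
  field
    bounded     : BoundedBy1 U
    countable   : Countable (M.Carrier U)
    homogeneous : HomogeneousMetric U
    universal   : (A : MetricQ) → FiniteMetric A → BoundedBy1 A → Isometry A U

induced : (U : MetricQ) → M.Carrier U → Echeloned
induced U x₀ = record
  { Carrier = M.Carrier U
  ; point   = x₀
  ; _≼_     = λ p q → d (proj₁ p) (proj₂ p) ≤ d (proj₁ q) (proj₂ q)
  ; ≼-refl  = λ _ → ℚP.≤-refl
  ; ≼-trans = ℚP.≤-trans
  ; ≼-total = λ p q → ℚP.≤-total _ _
  ; ax-diag = λ x y z → subst (_≤ d y z) (sym (d-self x)) (d-nonneg y z)
  ; ax-zero = λ x y z le → d-zero y z
                (ℚP.≤-antisym (subst (d y z ≤_) (d-self x) le) (d-nonneg y z))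
  ; ax-sym  = λ x y → ℚP.≤-reflexive (d-sym x y)
  }
  where open MetricQ U

-- An echeloned space isomorphic to F is homogeneous, and both Urysohn spaces
-- contain the five equally spaced points 0, 1/4, …, 1 of a line.  Inside the
-- induced echeloned space, the triangles {0, 1/4, 3/4} and {0, 1/4, 1} have
-- the same ordering of side lengths, so homogeneity yields an automorphism σ
-- fixing 0 and 1/4 and sending 3/4 to 1.  Automorphisms only see the order of
-- distances, so x = σ(1/2) lies within 1/4 of both 1/4 and 1 (the distances
-- 1/4–1/2 and 1/2–3/4 are not longer than 0–1/4), and the triangle inequality
-- gives 1 = d(0, 1) ≤ 1/4 + 1/4 + 1/4.
module Submission where

open import Defs
open import Data.Product using (_×_; _,_; proj₁; proj₂)
open import Relation.Nullary using (¬_)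

open import Data.Fin using (Fin; zero; suc; toℕ)
import Data.Fin as Fin
import Data.Fin.Properties as FinP
open import Data.Integer using (+_)
import Data.Nat as ℕ
open import Data.Rational using (ℚ; _/_; _≤_; _≤?_; _+_; 0ℚ; 1ℚ)
import Data.Rational.Properties as ℚP
open import Function using (_∘_)
open import Function.Bundles using (Inverse; Equivalence; _⇔_)
open import Function.Construct.Composition using (_⇔-∘_; _↔-∘_)
open import Function.Construct.Identity using (⇔-id; ↔-id)
open import Function.Construct.Symmetry using (⇔-sym; ↔-sym)
open import Relation.Binary.PropositionalEquality
  using (_≡_; refl; sym; trans; cong; subst₂)
open import Relation.Nullary.Decidable using (toWitness; _→-dec_; ¬?)

open Echeloned

≼-cong : (X : Echeloned) {x x′ y y′ z z′ w w′ : Carrier X} →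
         x ≡ x′ → y ≡ y′ → z ≡ z′ → w ≡ w′ →
         _≼_ X (x , y) (z , w) ⇔ _≼_ X (x′ , y′) (z′ , w′)
≼-cong X refl refl refl refl = ⇔-id _

EchIso-sym : {X Y : Echeloned} → EchIso X Y → EchIso Y X
EchIso-sym {X} {Y} φ = record
  { bij  = ↔-sym bij
  ; pres = λ x₁ y₁ x₂ y₂ → ⇔-sym
      (≼-cong Y (to∘from x₁) (to∘from y₁) (to∘from x₂) (to∘from y₂)
        ⇔-∘ pres (from x₁) (from y₁) (from x₂) (from y₂))
  }
  where
  open EchIso φ
  open Inverse bij using (from) renaming (strictlyInverseˡ to to∘from)

EchIso-trans : {X Y Z : Echeloned} → EchIso X Y → EchIso Y Z → EchIso X Z
EchIso-trans φ ψ = record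
  { bij  = EchIso.bij ψ ↔-∘ EchIso.bij φ
  ; pres = λ x₁ y₁ x₂ y₂ →
      EchIso.pres ψ _ _ _ _ ⇔-∘ EchIso.pres φ x₁ y₁ x₂ y₂
  }

EchIso-injective : {X Y : Echeloned} (φ : EchIso X Y) → InjectiveMap (EchIso.h φ)
EchIso-injective φ {x} {y} hx≡hy =
  trans (sym (from∘to x)) (trans (cong from hx≡hy) (from∘to y))
  where open Inverse (EchIso.bij φ) using (from) renaming (strictlyInverseʳ to from∘to)

HomogeneousEch-transport : {X Y : Echeloned} →
  EchIso X Y → HomogeneousEch X → HomogeneousEch Y
HomogeneousEch-transport {X} {Y} φ homX n a b a-inj b-inj a≈b =
  EchIso-trans (EchIso-trans φ⁻¹ σ) φ ,
  λ i → trans (cong (EchIso.h φ) (σa≡b i)) (Inverse.strictlyInverseˡ (EchIso.bij φ) (b i))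
  where
  φ⁻¹ = EchIso-sym φ
  pull : (Fin n → Carrier Y) → Fin n → Carrier X
  pull c = EchIso.h φ⁻¹ ∘ c
  pull-injective : {c : Fin n → Carrier Y} → InjectiveMap c → InjectiveMap (pull c)
  pull-injective c-inj = c-inj ∘ EchIso-injective φ⁻¹
  pull-a≈pull-b : ∀ i j k l →
    _≼_ X (pull a i , pull a j) (pull a k , pull a l) ⇔
    _≼_ X (pull b i , pull b j) (pull b k , pull b l)
  pull-a≈pull-b i j k l =
    EchIso.pres φ⁻¹ (b i) (b j) (b k) (b l)
      ⇔-∘ (a≈b i j k l ⇔-∘ ⇔-sym (EchIso.pres φ⁻¹ (a i) (a j) (a k) (a l)))
  σ-with-σa≡b = homX n (pull a) (pull b) (pull-injective a-inj) (pull-injective b-inj) pull-a≈pull-b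
  σ = proj₁ σ-with-σa≡b
  σa≡b = proj₂ σ-with-σa≡b

pathDist : Fin 5 → Fin 5 → ℚ
pathDist i j = + ℕ.∣ toℕ i - toℕ j ∣ / 4

path₅ : MetricQ
path₅ = record
  { Carrier  = Fin 5
  ; d        = pathDist
  ; d-nonneg = toWitness {a? = FinP.all? λ x → FinP.all? λ y → 0ℚ ≤? pathDist x y} _
  ; d-self   = toWitness {a? = FinP.all? λ x → pathDist x x ℚP.≟ 0ℚ} _
  ; d-zero   = toWitness {a? = FinP.all? λ x → FinP.all? λ y →
                 (pathDist x y ℚP.≟ 0ℚ) →-dec (x Fin.≟ y)} _
  ; d-sym    = toWitness {a? = FinP.all? λ x → FinP.all? λ y →
                 pathDist x y ℚP.≟ pathDist y x} _
  ; d-tri    = toWitness {a? = FinP.all? λ x → FinP.all? λ y → FinP.all? λ z →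
                 pathDist x z ≤? pathDist x y + pathDist y z} _
  }

path₅-bounded : BoundedBy1 path₅
path₅-bounded = toWitness {a? = FinP.all? λ x → FinP.all? λ y → pathDist x y ≤? 1ℚ} _

triangle₀₁₃ triangle₀₁₄ : Fin 3 → Fin 5
triangle₀₁₃ zero             = Fin.# 0
triangle₀₁₃ (suc zero)       = Fin.# 1
triangle₀₁₃ (suc (suc zero)) = Fin.# 3
triangle₀₁₄ zero             = Fin.# 0
triangle₀₁₄ (suc zero)       = Fin.# 1
triangle₀₁₄ (suc (suc zero)) = Fin.# 4

triangle₀₁₃-injective : InjectiveMap triangle₀₁₃
triangle₀₁₃-injective {i} {j} = toWitness {a? = FinP.all? λ i → FinP.all? λ j →
  (triangle₀₁₃ i Fin.≟ triangle₀₁₃ j) →-dec (i Fin.≟ j)} _ i j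

triangle₀₁₄-injective : InjectiveMap triangle₀₁₄
triangle₀₁₄-injective {i} {j} = toWitness {a? = FinP.all? λ i → FinP.all? λ j →
  (triangle₀₁₄ i Fin.≟ triangle₀₁₄ j) →-dec (i Fin.≟ j)} _ i j

-- Side lengths 1/4 < 2/4 < 3/4 against 1/4 < 3/4 < 1.
triangles-ordered-alike : ∀ i j k l →
  (pathDist (triangle₀₁₃ i) (triangle₀₁₃ j) ≤ pathDist (triangle₀₁₃ k) (triangle₀₁₃ l)) ⇔
  (pathDist (triangle₀₁₄ i) (triangle₀₁₄ j) ≤ pathDist (triangle₀₁₄ k) (triangle₀₁₄ l))
triangles-ordered-alike i j k l = record
  { to   = toWitness {a? = FinP.all? λ i → FinP.all? λ j → FinP.all? λ k → FinP.all? λ l →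
             (dist₀₁₃ i j ≤? dist₀₁₃ k l) →-dec (dist₀₁₄ i j ≤? dist₀₁₄ k l)} _ i j k l
  ; from = toWitness {a? = FinP.all? λ i → FinP.all? λ j → FinP.all? λ k → FinP.all? λ l →
             (dist₀₁₄ i j ≤? dist₀₁₄ k l) →-dec (dist₀₁₃ i j ≤? dist₀₁₃ k l)} _ i j k l
  ; to-cong   = λ { refl → refl }
  ; from-cong = λ { refl → refl }
  }
  where
  dist₀₁₃ dist₀₁₄ : Fin 3 → Fin 3 → ℚ
  dist₀₁₃ i j = pathDist (triangle₀₁₃ i) (triangle₀₁₃ j)
  dist₀₁₄ i j = pathDist (triangle₀₁₄ i) (triangle₀₁₄ j)

≤-cong : {p p′ q q′ : ℚ} → p ≡ p′ → q ≡ q′ → (p ≤ q) ⇔ (p′ ≤ q′)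
≤-cong refl refl = ⇔-id _

induced-not-homogeneous : (U : MetricQ) (x₀ : M.Carrier U) →
  Isometry path₅ U → ¬ HomogeneousEch (induced U x₀)
induced-not-homogeneous U x₀ ι hom = toWitness {a? = ¬? (1ℚ ≤? ¾)} _ 1≤¾
  where
  open MetricQ U using (d; d-tri)
  open Isometry ι renaming (h to u)
  open ℚP.≤-Reasoning

  ¾ : ℚ
  ¾ = pathDist (Fin.# 0) (Fin.# 3)

  a b : Fin 3 → M.Carrier U
  a = u ∘ triangle₀₁₃
  b = u ∘ triangle₀₁₄

  a≈b : ∀ i j k l → (d (a i) (a j) ≤ d (a k) (a l)) ⇔ (d (b i) (b j) ≤ d (b k) (b l))
  a≈b i j k l =
    ≤-cong (sym (pres _ _)) (sym (pres _ _))
      ⇔-∘ (triangles-ordered-alike i j k l ⇔-∘ ≤-cong (pres _ _) (pres _ _))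

  σ-with-σa≡b = hom 3 a b (triangle₀₁₃-injective ∘ inj) (triangle₀₁₄-injective ∘ inj) a≈b
  σ = EchIso.h (proj₁ σ-with-σa≡b)
  σa≡b = proj₂ σ-with-σa≡b

  σ-mono : ∀ {p q r s} → d p q ≤ d r s → d (σ p) (σ q) ≤ d (σ r) (σ s)
  σ-mono = Equivalence.to (EchIso.pres (proj₁ σ-with-σa≡b) _ _ _ _)

  u₀ u₁ u₂ u₃ u₄ x : M.Carrier U
  u₀ = u (Fin.# 0)
  u₁ = u (Fin.# 1)
  u₂ = u (Fin.# 2)
  u₃ = u (Fin.# 3)
  u₄ = u (Fin.# 4)
  x  = σ u₂

  σu₀₁≡u₀₁ : d (σ u₀) (σ u₁) ≡ d u₀ u₁
  σu₀₁≡u₀₁ rewrite σa≡b (Fin.# 0) | σa≡b (Fin.# 1) = refl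

  same-length : ∀ {i j k l} → pathDist i j ≡ pathDist k l → d (u i) (u j) ≡ d (u k) (u l)
  same-length {i} {j} {k} {l} e = trans (pres i j) (trans e (sym (pres k l)))

  x-near-u₁ : d u₁ x ≤ d u₀ u₁
  x-near-u₁ = subst₂ (λ p q → d p x ≤ q) (σa≡b (Fin.# 1)) σu₀₁≡u₀₁
    (σ-mono (ℚP.≤-reflexive (same-length refl)))

  x-near-u₄ : d x u₄ ≤ d u₀ u₁
  x-near-u₄ = subst₂ (λ p q → d x p ≤ q) (σa≡b (Fin.# 2)) σu₀₁≡u₀₁
    (σ-mono {p = u₂} {q = u₃} (ℚP.≤-reflexive (same-length refl)))

  1≤¾ : 1ℚ ≤ ¾
  1≤¾ = begin
    1ℚ                            ≡⟨ sym (pres (Fin.# 0) (Fin.# 4)) ⟩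
    d u₀ u₄                       ≤⟨ d-tri u₀ u₁ u₄ ⟩
    d u₀ u₁ + d u₁ u₄             ≤⟨ ℚP.+-monoʳ-≤ (d u₀ u₁) (d-tri u₁ x u₄) ⟩
    d u₀ u₁ + (d u₁ x + d x u₄)   ≤⟨ ℚP.+-monoʳ-≤ (d u₀ u₁) (ℚP.+-mono-≤ x-near-u₁ x-near-u₄) ⟩
    d u₀ u₁ + (d u₀ u₁ + d u₀ u₁) ≡⟨ cong (λ q → q + (q + q)) (pres (Fin.# 0) (Fin.# 1)) ⟩
    ¾                             ∎

corollary3p6 : (F : Echeloned) → IsFraisseLimitEch F →
    ((U : MetricQ) (hU : IsRationalUrysohn U) →
       ¬ EchIso F (induced U (proj₁ (IsRationalUrysohn.countable hU) 0)))
    × ((U : MetricQ) (hU : IsBoundedRationalUrysohn U) →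
       ¬ EchIso F (induced U (proj₁ (IsBoundedRationalUrysohn.countable hU) 0)))
corollary3p6 F hF =
  (λ U hU → not-iso (IsRationalUrysohn.universal hU path₅ (5 , ↔-id _))) ,
  (λ U hU → not-iso (IsBoundedRationalUrysohn.universal hU path₅ (5 , ↔-id _) path₅-bounded))
  where
  not-iso : {U : MetricQ} {x₀ : M.Carrier U} → Isometry path₅ U → ¬ EchIso F (induced U x₀)
  not-iso {U} {x₀} ι φ = induced-not-homogeneous U x₀ ι
    (HomogeneousEch-transport φ (IsFraisseLimitEch.homogeneous hF))
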